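{- Let $r,s$ be indeterminates and define the matrices $$ L' = \begin{bmatrix} 1 & 0\\ r & s \end{bmatrix} \quad\text{and}\quad R' = \begin{bmatrix} r & s\\ 0 & 1 \end{bmatrix}. $$ For $n\ge1$ with binary expansion $\beta(n)=b_1 b_2\ldots b_k$ (so $b_1=1$, and $n=\sum_{i=1}^k b_i 2^{k-i}$), let $M'(n)$ be the matrix product obtained by removing the initial $1$ from $\beta(n)$, reading the remaining digits backwards as $b_k b_{k-1}\ldots b_2$, and replacing each $0$ by $L'$ and each $1$ by $R'$ (the empty product being the identity matrix). A hyperbinary expansion of $n$ is a word $d=d_1d_2\ldots d_k$ of the same length $k$ as $\beta(n)$ with each $d_i\in\{0,1,2\}$ and $n=\sum_{i=1}^k d_i 2^{k-i}$; let ${\cal D}(n)$ be the set of hyperbinary expansions of $n$. For such $d$, let $t(d)$ be the number of twos in $d$, and $z(d)$ the number of nonleading zeros in $d$ (the number of zeros to the right of the leftmost nonzero digit of $d$). Define $$ h_{rs}(n) = \sum_{d\in{\cal D}(n)} r^{t(d)} s^{z(d)}. $$ Then $h_{rs}(-1)=0$, $h_{rs}(0) = 1$, and for $n\ge1$ \begin{align*} h_{rs}(2n-1) &= h_{rs}(n-1),\\ h_{rs}(2n) &= s\, h_{rs}(n) + r\, h_{rs}(n-1). \end{align*} Moreover, for all $n\ge0$, $$ M'(n) \begin{bmatrix} 1\\ 1 \end{bmatrix} = \begin{bmatrix} h_{rs}(n-1)\\ h_{rs}(n) \end{bmatrix}. $$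
   Context: The paper writes the generating function as $H_{rs}(n)$ in its definition but as $h_{rs}(n)$ in the theorem; they denote the same function. The matrices $L',R'$ generalize the $q$-analogues $L=\begin{bmatrix}1&0\\1&q^{ -1}\end{bmatrix}$, $R=\begin{bmatrix}q&1\\0&1\end{bmatrix}$ of the standard generators of $\mathrm{SL}(2,\mathbb{R})$. -}

module Defs where

open import Level using (Level)
open import Algebra.Bundles using (CommutativeSemiring)
open import Data.Bool using (Bool; true; false; if_then_else_)
open import Data.Nat using (ℕ; zero; suc; _≟_)
open import Data.Nat using () renaming (_+_ to _+ℕ_; _*_ to _*ℕ_; _^_ to _^ℕ_)
open import Data.Fin using (Fin; toℕ)
import Data.Fin as F
open import Data.List using (List; []; _∷_; length; map; concatMap; foldr)
open import Data.Vec using (Vec; []; _∷_)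
open import Data.Integer using (ℤ; +_; -[1+_])
open import Relation.Nullary using (does)

-- Binary expansion β(n), stored least-significant bit first
-- (true = 1, false = 0).  bitsL 0 = [] and bitsL n has no leading zero
-- (its last element is true for n ≥ 1).

inc : List Bool → List Bool
inc []           = true ∷ []
inc (false ∷ bs) = true ∷ bs
inc (true ∷ bs)  = false ∷ inc bs

bitsL : ℕ → List Bool
bitsL zero    = []
bitsL (suc n) = inc (bitsL n)

bitLength : ℕ → ℕ
bitLength n = length (bitsL n)

dropLast : {A : Set} → List A → List A
dropLast []           = []
dropLast (x ∷ [])     = []
dropLast (x ∷ y ∷ xs) = x ∷ dropLast (y ∷ xs)

allWords : (k : ℕ) → List (Vec (Fin 3) k)
allWords zero    = [] ∷ []
allWords (suc k) =
  concatMap (λ w → (F.zero ∷ w) ∷ (F.suc F.zero ∷ w) ∷ (F.suc (F.suc F.zero) ∷ w) ∷ [])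
            (allWords k)

value : {k : ℕ} → Vec (Fin 3) k → ℕ
value []            = 0
value {suc k} (d ∷ w) = toℕ d *ℕ (2 ^ℕ k) +ℕ value w

isZero : Fin 3 → Bool
isZero F.zero = true
isZero _      = false

isTwo : Fin 3 → Bool
isTwo (F.suc (F.suc F.zero)) = true
isTwo _                      = false

twos : {k : ℕ} → Vec (Fin 3) k → ℕ
twos []      = 0
twos (d ∷ w) = (if isTwo d then 1 else 0) +ℕ twos w

zeros : {k : ℕ} → Vec (Fin 3) k → ℕ
zeros []      = 0
zeros (d ∷ w) = (if isZero d then 1 else 0) +ℕ zeros w

nonleadingZeros : {k : ℕ} → Vec (Fin 3) k → ℕ
nonleadingZeros []      = 0
nonleadingZeros (d ∷ w) = if isZero d then nonleadingZeros w else zeros w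

record Mat2 {a : Level} (A : Set a) : Set a where
  constructor mat
  field
    a₁₁ a₁₂ a₂₁ a₂₂ : A

module HRS {c ℓ : Level} (R : CommutativeSemiring c ℓ)
           (r s : CommutativeSemiring.Carrier R) where
  open CommutativeSemiring R
  open import Algebra.Definitions.RawSemiring rawSemiring using (_^_)

  sumL : List Carrier → Carrier
  sumL = foldr _+_ 0#

  weight : {k : ℕ} → Vec (Fin 3) k → Carrier
  weight w = (r ^ twos w) * (s ^ nonleadingZeros w)

  h : ℕ → Carrier
  h n = sumL (map (λ w → if does (value w ≟ n) then weight w else 0#)
                  (allWords (bitLength n)))

  -- extension to ℤ: negative integers have no hyperbinary expansion
  hz : ℤ → Carrier
  hz (+ n)      = h n
  hz -[1+ n ]   = 0#

  mul : Mat2 Carrier → Mat2 Carrier → Mat2 Carrier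
  mul (mat a b c' d) (mat e f g k) =
    mat (a * e + b * g) (a * f + b * k) (c' * e + d * g) (c' * f + d * k)

  I₂ : Mat2 Carrier
  I₂ = mat 1# 0# 0# 1#

  L′ : Mat2 Carrier
  L′ = mat 1# 0# r s

  R′ : Mat2 Carrier
  R′ = mat r s 0# 1#

  digitMat : Bool → Mat2 Carrier
  digitMat false = L′
  digitMat true  = R′

  prodMats : List Bool → Mat2 Carrier
  prodMats []       = I₂
  prodMats (b ∷ bs) = mul (digitMat b) (prodMats bs)

  -- M'(n): drop the leading 1 of β(n) and read the remaining digits
  -- backwards b_k b_{k-1} … b_2 (bitsL is already LSB-first).
  M′ : ℕ → Mat2 Carrier
  M′ n = prodMats (dropLast (bitsL n))

  -- first and second entries of M · [1,1]ᵀ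
  row₁ row₂ : Mat2 Carrier → Carrier
  row₁ (mat a b _ _) = a + b
  row₂ (mat _ _ c' d) = c' + d

{-# OPTIONS --safe #-}
module Submission where

open import Defs
open import Algebra.Bundles using (CommutativeMonoid; CommutativeSemiring)
open import Data.Nat using (ℕ; zero; suc)
import Data.Nat as ℕ
import Data.Nat.Properties as ℕₚ
open import Data.Integer using (ℤ; +_; -[1+_])
import Data.Integer as ℤ
open import Data.Product using (_×_; _,_; proj₁; proj₂)

open import Data.Bool using (Bool; true; false; if_then_else_)
open import Data.Fin using (Fin; toℕ)
import Data.Fin as F
open import Data.Fin.Patterns using (0F; 1F; 2F)
open import Data.List using (List; []; _∷_; _++_; length; map; concatMap; foldr)
open import Data.List.Properties using (map-++)
open import Data.Vec using (Vec; []; _∷_; _∷ʳ_)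
open import Function using (_∘_)
open import Relation.Binary.PropositionalEquality as ≡ using (_≡_; _≢_)

-- Split the sum defining h(m) according to the last digit e of the hyperbinary word:
-- removing e leaves a word of value (m − e)/2 and divides the weight by s (e = 0, a
-- nonleading zero), 1 (e = 1) or r (e = 2).  Parity leaves the single choice e = 1 when
-- m is odd and the choices e = 0, 2 when m is even, which gives the two recurrences.
-- Leading zeros do not change the weight, so the length of the words summed over is
-- irrelevant once it is at least that of β(m).  Left multiplication by L′ and R′ acts
-- on (h(n − 1), h(n)) exactly as these recurrences act when n becomes 2n or 2n + 1, so
-- the matrix identity follows by induction on the binary expansion.

module BinaryExpansion where
  open ≡ using (refl; trans; cong; subst)
  open import Data.Nat using (_+_; _*_; _^_; _≤_; _<_; z≤n; s≤s; z<s)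
  open import Data.Nat.Properties
    using (*-suc; ≤-refl; +-monoˡ-≤; *-monoʳ-≤; n<1+n; module ≤-Reasoning)

  bitsValue : List Bool → ℕ
  bitsValue []       = 0
  bitsValue (b ∷ bs) = (if b then 1 else 0) + 2 * bitsValue bs

  bitsValue-inc : ∀ bs → bitsValue (inc bs) ≡ suc (bitsValue bs)
  bitsValue-inc []           = refl
  bitsValue-inc (false ∷ bs) = refl
  bitsValue-inc (true ∷ bs)  = trans (cong (2 *_) (bitsValue-inc bs)) (*-suc 2 (bitsValue bs))

  bitsValue-bitsL : ∀ n → bitsValue (bitsL n) ≡ n
  bitsValue-bitsL zero    = refl
  bitsValue-bitsL (suc n) = trans (bitsValue-inc (bitsL n)) (cong suc (bitsValue-bitsL n))

  bitsValue<2^length : ∀ bs → bitsValue bs < 2 ^ length bs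
  bitsValue<2^length []       = z<s
  bitsValue<2^length (b ∷ bs) = begin-strict
    (if b then 1 else 0) + 2 * bitsValue bs  ≤⟨ +-monoˡ-≤ (2 * bitsValue bs) (bit≤1 b) ⟩
    1 + 2 * bitsValue bs                     <⟨ n<1+n _ ⟩
    2 + 2 * bitsValue bs                     ≡⟨ *-suc 2 (bitsValue bs) ⟨
    2 * suc (bitsValue bs)                   ≤⟨ *-monoʳ-≤ 2 (bitsValue<2^length bs) ⟩
    2 * 2 ^ length bs                        ∎
    where
    open ≤-Reasoning
    bit≤1 : ∀ b → (if b then 1 else 0) ≤ 1
    bit≤1 true  = ≤-refl
    bit≤1 false = z≤n

  n<2^bitLength : ∀ n → n < 2 ^ bitLength n
  n<2^bitLength n = subst (_< 2 ^ bitLength n) (bitsValue-bitsL n) (bitsValue<2^length (bitsL n))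

  length-inc : ∀ bs → length bs ≤ length (inc bs)
  length-inc []           = z≤n
  length-inc (false ∷ bs) = ≤-refl
  length-inc (true ∷ bs)  = s≤s (length-inc bs)

  bitsL-even : ∀ n → bitsL (suc (suc (2 * n))) ≡ false ∷ bitsL (suc n)
  bitsL-even zero    = refl
  bitsL-even (suc n) =
    trans (cong (λ x → bitsL (suc (suc x))) (*-suc 2 n)) (cong (inc ∘ inc) (bitsL-even n))

  bitsL-odd : ∀ n → bitsL (suc (2 * n)) ≡ true ∷ bitsL n
  bitsL-odd zero    = refl
  bitsL-odd (suc n) = trans (cong (bitsL ∘ suc) (*-suc 2 n)) (cong inc (bitsL-even n))

  dropLast-∷-inc : ∀ (b : Bool) bs → dropLast (b ∷ inc bs) ≡ b ∷ dropLast (inc bs)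
  dropLast-∷-inc b []           = refl
  dropLast-∷-inc b (false ∷ bs) = refl
  dropLast-∷-inc b (true ∷ bs)  = refl

open BinaryExpansion

module Words where
  open ≡ using (refl; sym; trans; cong)
  open import Data.Nat using (_+_; _*_; _^_; _≤_)
  open import Data.Nat.Properties
    using (*-identityʳ; +-identityʳ; +-assoc; +-comm; +-cancelˡ-≡; *-cancelˡ-≡;
           m≤m+n; ≤-trans)
  open import Data.Nat.Tactic.RingSolver using (solve-∀)
  open import Relation.Nullary using (contradiction)

  Word : ℕ → Set
  Word = Vec (Fin 3)

  value-∷ʳ : ∀ {K} (w : Word K) e → value (w ∷ʳ e) ≡ toℕ e + 2 * value w
  value-∷ʳ []              e = cong (_+ 0) (*-identityʳ (toℕ e))
  value-∷ʳ {suc K} (d ∷ w) e =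
    trans (cong (_+_ (toℕ d * 2 ^ suc K)) (value-∷ʳ w e))
          (shift (toℕ d) (2 ^ K) (toℕ e) (value w))
    where
    shift : ∀ x p y v → x * (2 * p) + (y + 2 * v) ≡ y + 2 * (x * p + v)
    shift = solve-∀

  value-∷ʳ-cancel : ∀ {K} (w : Word K) e {n} →
                    value (w ∷ʳ e) ≡ toℕ e + 2 * n → value w ≡ n
  value-∷ʳ-cancel w e {n} eq =
    *-cancelˡ-≡ (value w) n 2 (+-cancelˡ-≡ (toℕ e) _ _ (trans (sym (value-∷ʳ w e)) eq))

  2^K≤value-suc∷ : ∀ {K} (d : Fin 2) (w : Word K) → 2 ^ K ≤ value (F.suc d ∷ w)
  2^K≤value-suc∷ {K} d w = ≤-trans (m≤m+n (2 ^ K) _) (m≤m+n _ (value w))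

  twos-∷ʳ : ∀ {K} (w : Word K) e → twos (w ∷ʳ e) ≡ twos w + twos (e ∷ [])
  twos-∷ʳ []      e = refl
  twos-∷ʳ (d ∷ w) e =
    trans (cong (_+_ _) (twos-∷ʳ w e)) (sym (+-assoc (if isTwo d then 1 else 0) (twos w) _))

  zeros-∷ʳ : ∀ {K} (w : Word K) e → zeros (w ∷ʳ e) ≡ zeros w + zeros (e ∷ [])
  zeros-∷ʳ []      e = refl
  zeros-∷ʳ (d ∷ w) e =
    trans (cong (_+_ _) (zeros-∷ʳ w e)) (sym (+-assoc (if isZero d then 1 else 0) (zeros w) _))

  nonleadingZeros-∷ʳ-suc : ∀ {K} (w : Word K) (d : Fin 2) →
                           nonleadingZeros (w ∷ʳ F.suc d) ≡ nonleadingZeros w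
  nonleadingZeros-∷ʳ-suc []             d = refl
  nonleadingZeros-∷ʳ-suc (0F ∷ w)       d = nonleadingZeros-∷ʳ-suc w d
  nonleadingZeros-∷ʳ-suc (F.suc _ ∷ w) d =
    trans (zeros-∷ʳ w (F.suc d)) (+-identityʳ (zeros w))

  nonleadingZeros-∷ʳ-zero : ∀ {K} (w : Word K) → value w ≢ 0 →
                            nonleadingZeros (w ∷ʳ 0F) ≡ suc (nonleadingZeros w)
  nonleadingZeros-∷ʳ-zero []             v≢0 = contradiction refl v≢0
  nonleadingZeros-∷ʳ-zero (0F ∷ w)       v≢0 = nonleadingZeros-∷ʳ-zero w v≢0
  nonleadingZeros-∷ʳ-zero (F.suc _ ∷ w) _   = trans (zeros-∷ʳ w 0F) (+-comm (zeros w) 1)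

open Words

module WordSums {c ℓ} (M : CommutativeMonoid c ℓ) where
  open CommutativeMonoid M renaming (_∙_ to _+_; ε to 0#)
  open import Algebra.Properties.CommutativeMonoid.Sum M
    using (sum-syntax; sum-cong-≋; ∑-distrib-+; ∑-comm)
  open import Relation.Binary.Reasoning.Setoid setoid

  sumWords : ∀ {n} K → (Vec (Fin n) K → Carrier) → Carrier
  sumWords         zero    G = G []
  sumWords {n} (suc K) G = sumWords K (λ w → ∑[ d < n ] G (d ∷ w))

  sumWords-cong : ∀ {n} K {G H : Vec (Fin n) K → Carrier} →
                  (∀ w → G w ≈ H w) → sumWords K G ≈ sumWords K H
  sumWords-cong zero    G≈H = G≈H []
  sumWords-cong (suc K) G≈H = sumWords-cong K (λ w → sum-cong-≋ (λ d → G≈H (d ∷ w)))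

  sumWords-distrib-+ : ∀ {n} K (G H : Vec (Fin n) K → Carrier) →
                       sumWords K (λ w → G w + H w) ≈ sumWords K G + sumWords K H
  sumWords-distrib-+ zero    G H = refl
  sumWords-distrib-+ (suc K) G H =
    trans (sumWords-cong K (λ w → ∑-distrib-+ (λ d → G (d ∷ w)) (λ d → H (d ∷ w))))
          (sumWords-distrib-+ K _ _)

  sumWords-∷ʳ : ∀ {n} K (G : Vec (Fin n) (suc K) → Carrier) →
                sumWords (suc K) G ≈ sumWords K (λ w → ∑[ e < n ] G (w ∷ʳ e))
  sumWords-∷ʳ         zero    G = refl
  sumWords-∷ʳ {n} (suc K) G =
    trans (sumWords-∷ʳ K (λ u → ∑[ d < n ] G (d ∷ u)))
          (sumWords-cong K (λ w → ∑-comm (λ e d → G (d ∷ (w ∷ʳ e)))))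

  foldr-++ : ∀ xs ys → foldr _+_ 0# (xs ++ ys) ≈ foldr _+_ 0# xs + foldr _+_ 0# ys
  foldr-++ []       ys = sym (identityˡ _)
  foldr-++ (x ∷ xs) ys = trans (∙-congˡ (foldr-++ xs ys)) (sym (assoc x _ _))

  foldr-concatMap : ∀ {A B : Set} (G : B → Carrier) (f : A → List B) xs →
                    foldr _+_ 0# (map G (concatMap f xs)) ≈
                    foldr _+_ 0# (map (λ x → foldr _+_ 0# (map G (f x))) xs)
  foldr-concatMap G f []       = refl
  foldr-concatMap G f (x ∷ xs) = begin
    foldr _+_ 0# (map G (f x ++ concatMap f xs))
      ≡⟨ ≡.cong (foldr _+_ 0#) (map-++ G (f x) _) ⟩
    foldr _+_ 0# (map G (f x) ++ map G (concatMap f xs))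
      ≈⟨ foldr-++ (map G (f x)) _ ⟩
    foldr _+_ 0# (map G (f x)) + foldr _+_ 0# (map G (concatMap f xs))
      ≈⟨ ∙-congˡ (foldr-concatMap G f xs) ⟩
    foldr _+_ 0# (map (λ x → foldr _+_ 0# (map G (f x))) (x ∷ xs)) ∎

  foldr-allWords : ∀ K (G : Word K → Carrier) →
                   foldr _+_ 0# (map G (allWords K)) ≈ sumWords K G
  foldr-allWords zero    G = identityʳ (G [])
  foldr-allWords (suc K) G = trans (foldr-concatMap G _ (allWords K)) (foldr-allWords K _)

module Hyperbinary {c ℓ} (R : CommutativeSemiring c ℓ) (r s : CommutativeSemiring.Carrier R)
  where
  open CommutativeSemiring R
  open HRS R r s
  open WordSums +-commutativeMonoid
    using (sumWords; sumWords-cong; sumWords-distrib-+; sumWords-∷ʳ; foldr-allWords)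
  open import Algebra.Definitions.RawSemiring rawSemiring using (_^_)
  open import Algebra.Properties.Semiring.Sum semiring using (sum-syntax; *-distribˡ-sum)
  open import Algebra.Properties.CommutativeSemigroup *-commutativeSemigroup using (x∙yz≈y∙xz)
  open import Algebra.Solver.Ring.NaturalCoefficients.Default R using (solve; _:=_; _:+_; _:*_)
  open import Relation.Binary.Reasoning.Setoid setoid
  open import Data.Nat using (_≟_; _≤′_; ≤′-refl; ≤′-reflexive; ≤′-step)
  open import Data.Nat.Properties
    using (*-suc; even≢odd; suc-injective; 1+n≢0; <⇒≱; <-≤-trans; ^-monoʳ-≤;
           ≤′⇒≤; ≤⇒≤′)
  open import Data.Nat.Binary as ℕᵇ using (ℕᵇ; zero; 2[1+_]; 1+[2_])
  open import Data.Nat.Binary.Properties using (toℕ-fromℕ)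
  open import Relation.Nullary using (does; yes; no)
  open import Relation.Nullary.Decidable using (dec-true; dec-false)

  *-distribˡ-sumWords : ∀ {n} K x (G : Vec (Fin n) K → Carrier) →
                        x * sumWords K G ≈ sumWords K (λ w → x * G w)
  *-distribˡ-sumWords zero    x G = refl
  *-distribˡ-sumWords (suc K) x G =
    trans (*-distribˡ-sumWords K x _)
          (sumWords-cong K (λ w → *-distribˡ-sum x (λ d → G (d ∷ w))))

  summand : ℕ → ∀ {K} → Word K → Carrier
  summand m w = if does (value w ≟ m) then weight w else 0#

  summand-match : ∀ {K m} (w : Word K) → value w ≡ m → summand m w ≡ weight w
  summand-match {m = m} w eq rewrite dec-true (value w ≟ m) eq = ≡.refl

  summand-miss : ∀ {K m} (w : Word K) → value w ≢ m → summand m w ≡ 0#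
  summand-miss {m = m} w ne rewrite dec-false (value w ≟ m) ne = ≡.refl

  weight-∷ʳ-zero : ∀ {K} (w : Word K) → value w ≢ 0 →
                   weight (w ∷ʳ 0F) ≈ s * weight w
  weight-∷ʳ-zero w v≢0 = begin
    r ^ twos (w ∷ʳ 0F) * s ^ nonleadingZeros (w ∷ʳ 0F)
      ≡⟨ ≡.cong₂ (λ t z → r ^ t * s ^ z)
                 (≡.trans (twos-∷ʳ w 0F) (ℕₚ.+-identityʳ _)) (nonleadingZeros-∷ʳ-zero w v≢0) ⟩
    r ^ twos w * (s * s ^ nonleadingZeros w)
      ≈⟨ x∙yz≈y∙xz _ _ _ ⟩
    s * weight w ∎

  weight-∷ʳ-one : ∀ {K} (w : Word K) → weight (w ∷ʳ 1F) ≡ weight w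
  weight-∷ʳ-one w = ≡.cong₂ (λ t z → r ^ t * s ^ z)
    (≡.trans (twos-∷ʳ w 1F) (ℕₚ.+-identityʳ _)) (nonleadingZeros-∷ʳ-suc w 0F)

  weight-∷ʳ-two : ∀ {K} (w : Word K) → weight (w ∷ʳ 2F) ≈ r * weight w
  weight-∷ʳ-two w = begin
    r ^ twos (w ∷ʳ 2F) * s ^ nonleadingZeros (w ∷ʳ 2F)
      ≡⟨ ≡.cong₂ (λ t z → r ^ t * s ^ z)
                 (≡.trans (twos-∷ʳ w 2F) (ℕₚ.+-comm _ 1)) (nonleadingZeros-∷ʳ-suc w 1F) ⟩
    (r * r ^ twos w) * s ^ nonleadingZeros w
      ≈⟨ *-assoc _ _ _ ⟩
    r * weight w ∎

  summand-∷ʳ : ∀ {K} e n {m} (c : Carrier) → toℕ e ℕ.+ 2 ℕ.* n ≡ m →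
               (∀ (w : Word K) → value w ≡ n → weight (w ∷ʳ e) ≈ c * weight w) →
               ∀ (w : Word K) → summand m (w ∷ʳ e) ≈ c * summand n w
  summand-∷ʳ e n c ≡.refl weight-∷ʳ w with value w ≟ n
  ... | yes v≡n = begin
    summand (toℕ e ℕ.+ 2 ℕ.* n) (w ∷ʳ e)  ≡⟨ summand-match (w ∷ʳ e) value≡ ⟩
    weight (w ∷ʳ e)                       ≈⟨ weight-∷ʳ w v≡n ⟩
    c * weight w                          ≡⟨ ≡.cong (c *_) (summand-match w v≡n) ⟨
    c * summand n w                       ∎
    where
    value≡ : value (w ∷ʳ e) ≡ toℕ e ℕ.+ 2 ℕ.* n
    value≡ = ≡.trans (value-∷ʳ w e) (≡.cong (λ v → toℕ e ℕ.+ 2 ℕ.* v) v≡n)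
  ... | no v≢n = begin
    summand (toℕ e ℕ.+ 2 ℕ.* n) (w ∷ʳ e)
      ≡⟨ summand-miss (w ∷ʳ e) (v≢n ∘ value-∷ʳ-cancel w e) ⟩
    0#                                    ≈⟨ zeroʳ c ⟨
    c * 0#                                ≡⟨ ≡.cong (c *_) (summand-miss w v≢n) ⟨
    c * summand n w                       ∎

  summand-∷ʳ-miss : ∀ {K} e {m} → (∀ v → toℕ e ℕ.+ 2 ℕ.* v ≢ m) →
                    ∀ (w : Word K) → summand m (w ∷ʳ e) ≡ 0#
  summand-∷ʳ-miss e ne w =
    summand-miss (w ∷ʳ e) (ne (value w) ∘ ≡.trans (≡.sym (value-∷ʳ w e)))

  -- A leading 0 changes neither value nor weight, definitionally.
  sumWords-pad : ∀ {K m} → m ℕ.< 2 ℕ.^ K →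
                 sumWords (suc K) (summand m) ≈ sumWords K (summand m)
  sumWords-pad {K} {m} m<2^K = sumWords-cong K leadingDigit
    where
    leadingTooBig : ∀ d (w : Word K) → summand m (F.suc d ∷ w) ≡ 0#
    leadingTooBig d w = summand-miss (F.suc d ∷ w)
      (λ eq → <⇒≱ m<2^K (≡.subst (2 ℕ.^ K ℕ.≤_) eq (2^K≤value-suc∷ d w)))
    leadingDigit : ∀ w → ∑[ d < 3 ] summand m (d ∷ w) ≈ summand m w
    leadingDigit w = begin
      summand m w + (summand m (1F ∷ w) + (summand m (2F ∷ w) + 0#))
        ≡⟨ ≡.cong₂ (λ x y → summand m w + (x + (y + 0#)))
                   (leadingTooBig 0F w) (leadingTooBig 1F w) ⟩
      summand m w + (0# + (0# + 0#))
        ≈⟨ trans (+-congˡ (trans (+-identityˡ _) (+-identityʳ 0#))) (+-identityʳ _) ⟩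
      summand m w ∎

  h≈sumWords : ∀ m {K} → bitLength m ≤′ K → h m ≈ sumWords K (summand m)
  h≈sumWords m ≤′-refl           = foldr-allWords (bitLength m) (summand m)
  h≈sumWords m (≤′-step {K} le) = trans (h≈sumWords m le) (sym (sumWords-pad {K} {m} m<2^K))
    where
    m<2^K : m ℕ.< 2 ℕ.^ K
    m<2^K = <-≤-trans (n<2^bitLength m) (^-monoʳ-≤ 2 (≤′⇒≤ le))

  sumWords-odd : ∀ K n → sumWords (suc K) (summand (suc (2 ℕ.* n))) ≈ sumWords K (summand n)
  sumWords-odd K n = trans (sumWords-∷ʳ K (summand m)) (sumWords-cong K lastDigit)
    where
    m : ℕ
    m = suc (2 ℕ.* n)
    digit0 : ∀ w → summand m (w ∷ʳ 0F) ≡ 0#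
    digit0 = summand-∷ʳ-miss 0F (λ v → even≢odd v n)
    digit1 : ∀ w → summand m (w ∷ʳ 1F) ≈ summand n w
    digit1 w = begin
      summand m (w ∷ʳ 1F)  ≈⟨ summand-∷ʳ 1F n 1# ≡.refl weight1 w ⟩
      1# * summand n w     ≈⟨ *-identityˡ _ ⟩
      summand n w          ∎
      where
      weight1 : ∀ (w : Word _) → value w ≡ n → weight (w ∷ʳ 1F) ≈ 1# * weight w
      weight1 w _ = trans (reflexive (weight-∷ʳ-one w)) (sym (*-identityˡ _))
    digit2 : ∀ w → summand m (w ∷ʳ 2F) ≡ 0#
    digit2 = summand-∷ʳ-miss 2F (λ v → even≢odd n v ∘ ≡.sym ∘ suc-injective)
    lastDigit : ∀ w → ∑[ e < 3 ] summand m (w ∷ʳ e) ≈ summand n w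
    lastDigit w = begin
      summand m (w ∷ʳ 0F) + (summand m (w ∷ʳ 1F) + (summand m (w ∷ʳ 2F) + 0#))
        ≈⟨ +-cong (reflexive (digit0 w))
                  (+-cong (digit1 w) (+-congʳ (reflexive (digit2 w)))) ⟩
      0# + (summand n w + (0# + 0#))
        ≈⟨ trans (+-identityˡ _) (trans (+-congˡ (+-identityˡ 0#)) (+-identityʳ _)) ⟩
      summand n w ∎

  sumWords-even : ∀ K n → sumWords (suc K) (summand (suc (suc (2 ℕ.* n)))) ≈
                          s * sumWords K (summand (suc n)) + r * sumWords K (summand n)
  sumWords-even K n = begin
    sumWords (suc K) (summand m)
      ≈⟨ sumWords-∷ʳ K (summand m) ⟩
    sumWords K (λ w → ∑[ e < 3 ] summand m (w ∷ʳ e))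
      ≈⟨ sumWords-cong K lastDigit ⟩
    sumWords K (λ w → s * summand (suc n) w + r * summand n w)
      ≈⟨ sumWords-distrib-+ K _ _ ⟩
    sumWords K (λ w → s * summand (suc n) w) + sumWords K (λ w → r * summand n w)
      ≈⟨ +-cong (*-distribˡ-sumWords K s (summand (suc n)))
                (*-distribˡ-sumWords K r (summand n)) ⟨
    s * sumWords K (summand (suc n)) + r * sumWords K (summand n) ∎
    where
    m : ℕ
    m = suc (suc (2 ℕ.* n))
    digit0 : ∀ w → summand m (w ∷ʳ 0F) ≈ s * summand (suc n) w
    digit0 = summand-∷ʳ 0F (suc n) s (*-suc 2 n)
               (λ w v≡1+n → weight-∷ʳ-zero w (1+n≢0 ∘ ≡.trans (≡.sym v≡1+n)))
    digit1 : ∀ w → summand m (w ∷ʳ 1F) ≡ 0#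
    digit1 = summand-∷ʳ-miss 1F (λ v → even≢odd v n ∘ suc-injective)
    digit2 : ∀ w → summand m (w ∷ʳ 2F) ≈ r * summand n w
    digit2 = summand-∷ʳ 2F n r ≡.refl (λ w _ → weight-∷ʳ-two w)
    lastDigit : ∀ w →
                ∑[ e < 3 ] summand m (w ∷ʳ e) ≈ s * summand (suc n) w + r * summand n w
    lastDigit w = begin
      summand m (w ∷ʳ 0F) + (summand m (w ∷ʳ 1F) + (summand m (w ∷ʳ 2F) + 0#))
        ≈⟨ +-cong (digit0 w) (+-cong (reflexive (digit1 w)) (+-congʳ (digit2 w))) ⟩
      s * summand (suc n) w + (0# + (r * summand n w + 0#))
        ≈⟨ +-congˡ (trans (+-identityˡ _) (+-identityʳ _)) ⟩
      s * summand (suc n) w + r * summand n w ∎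

  h-zero : h 0 ≈ 1#
  h-zero = trans (+-identityʳ _) (*-identityˡ 1#)

  h-odd : ∀ n → h (suc (2 ℕ.* n)) ≈ h n
  h-odd n = begin
    h (suc (2 ℕ.* n))
      ≈⟨ h≈sumWords _ (≤′-reflexive (≡.cong length (bitsL-odd n))) ⟩
    sumWords (suc K) (summand (suc (2 ℕ.* n)))
      ≈⟨ sumWords-odd K n ⟩
    sumWords K (summand n)
      ≈⟨ h≈sumWords n ≤′-refl ⟨
    h n ∎
    where
    K : ℕ
    K = bitLength n

  h-even : ∀ n → h (suc (suc (2 ℕ.* n))) ≈ s * h (suc n) + r * h n
  h-even n = begin
    h (suc (suc (2 ℕ.* n)))
      ≈⟨ h≈sumWords _ (≤′-reflexive (≡.cong length (bitsL-even n))) ⟩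
    sumWords (suc K) (summand (suc (suc (2 ℕ.* n))))
      ≈⟨ sumWords-even K n ⟩
    s * sumWords K (summand (suc n)) + r * sumWords K (summand n)
      ≈⟨ +-cong (*-congˡ (h≈sumWords (suc n) ≤′-refl))
                (*-congˡ (h≈sumWords n (≤⇒≤′ (length-inc (bitsL n))))) ⟨
    s * h (suc n) + r * h n ∎
    where
    K : ℕ
    K = bitLength (suc n)

  M′-even : ∀ m → M′ (suc (suc (2 ℕ.* m))) ≡ mul L′ (M′ (suc m))
  M′-even m = ≡.trans (≡.cong (prodMats ∘ dropLast) (bitsL-even m))
                      (≡.cong prodMats (dropLast-∷-inc false (bitsL m)))

  M′-odd : ∀ m → M′ (suc (2 ℕ.* suc m)) ≡ mul R′ (M′ (suc m))
  M′-odd m = ≡.trans (≡.cong (prodMats ∘ dropLast) (bitsL-odd (suc m)))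
                     (≡.cong prodMats (dropLast-∷-inc true (bitsL m)))

  row₁-L′ : ∀ M → row₁ (mul L′ M) ≈ row₁ M
  row₁-L′ (mat a b c d) = +-cong (unit a c) (unit b d)
    where
    unit : ∀ x y → 1# * x + 0# * y ≈ x
    unit x y = trans (+-cong (*-identityˡ x) (zeroˡ y)) (+-identityʳ x)

  row₂-R′ : ∀ M → row₂ (mul R′ M) ≈ row₂ M
  row₂-R′ (mat a b c d) = +-cong (unit a c) (unit b d)
    where
    unit : ∀ x y → 0# * x + 1# * y ≈ y
    unit x y = trans (+-cong (zeroˡ x) (*-identityˡ y)) (+-identityˡ y)

  row-r-s : ∀ a b c d → (r * a + s * c) + (r * b + s * d) ≈ s * (c + d) + r * (a + b)
  row-r-s = solve 6 (λ r s a b c d → (r :* a :+ s :* c) :+ (r :* b :+ s :* d)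
                                   := s :* (c :+ d) :+ r :* (a :+ b)) refl r s

  row₂-L′ : ∀ M → row₂ (mul L′ M) ≈ s * row₂ M + r * row₁ M
  row₂-L′ (mat a b c d) = row-r-s a b c d

  row₁-R′ : ∀ M → row₁ (mul R′ M) ≈ s * row₂ M + r * row₁ M
  row₁-R′ (mat a b c d) = row-r-s a b c d

  M′-rows≈h : ℕ → Set ℓ
  M′-rows≈h n = row₁ (M′ (suc n)) ≈ h n × row₂ (M′ (suc n)) ≈ h (suc n)

  M′-rows-even : ∀ m → M′-rows≈h m →
                 s * row₂ (M′ (suc m)) + r * row₁ (M′ (suc m)) ≈ h (suc (suc (2 ℕ.* m)))
  M′-rows-even m (row₁≈ , row₂≈) =
    trans (+-cong (*-congˡ row₂≈) (*-congˡ row₁≈)) (sym (h-even m))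

  -- Indexing by n + 1, the constructors 1+[2_] and 2[1+_] of ℕᵇ are the steps n ↦ 2n and
  -- n ↦ 2n + 1, which prepend L′ and R′ to M′.
  M′-rows≈h-ℕᵇ : ∀ (x : ℕᵇ) → M′-rows≈h (ℕᵇ.toℕ x)
  M′-rows≈h-ℕᵇ zero =
    trans (+-identityʳ 1#) (sym h-zero) , trans (+-identityˡ 1#) (sym (trans (h-odd 0) h-zero))
  M′-rows≈h-ℕᵇ 1+[2 x ] = first , second
    where
    m : ℕ
    m = ℕᵇ.toℕ x
    ih : M′-rows≈h m
    ih = M′-rows≈h-ℕᵇ x
    first : row₁ (M′ (suc (suc (2 ℕ.* m)))) ≈ h (suc (2 ℕ.* m))
    first = begin
      row₁ (M′ (suc (suc (2 ℕ.* m))))  ≡⟨ ≡.cong row₁ (M′-even m) ⟩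
      row₁ (mul L′ (M′ (suc m)))       ≈⟨ row₁-L′ _ ⟩
      row₁ (M′ (suc m))                ≈⟨ proj₁ ih ⟩
      h m                              ≈⟨ h-odd m ⟨
      h (suc (2 ℕ.* m))                ∎
    second : row₂ (M′ (suc (suc (2 ℕ.* m)))) ≈ h (suc (suc (2 ℕ.* m)))
    second = begin
      row₂ (M′ (suc (suc (2 ℕ.* m))))  ≡⟨ ≡.cong row₂ (M′-even m) ⟩
      row₂ (mul L′ (M′ (suc m)))       ≈⟨ row₂-L′ _ ⟩
      _                                ≈⟨ M′-rows-even m ih ⟩
      h (suc (suc (2 ℕ.* m)))          ∎
  M′-rows≈h-ℕᵇ 2[1+ x ] = first , second
    where
    m : ℕ
    m = ℕᵇ.toℕ x
    ih : M′-rows≈h m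
    ih = M′-rows≈h-ℕᵇ x
    first : row₁ (M′ (suc (2 ℕ.* suc m))) ≈ h (2 ℕ.* suc m)
    first = begin
      row₁ (M′ (suc (2 ℕ.* suc m)))  ≡⟨ ≡.cong row₁ (M′-odd m) ⟩
      row₁ (mul R′ (M′ (suc m)))     ≈⟨ row₁-R′ _ ⟩
      _                              ≈⟨ M′-rows-even m ih ⟩
      h (suc (suc (2 ℕ.* m)))        ≡⟨ ≡.cong h (*-suc 2 m) ⟨
      h (2 ℕ.* suc m)                ∎
    second : row₂ (M′ (suc (2 ℕ.* suc m))) ≈ h (suc (2 ℕ.* suc m))
    second = begin
      row₂ (M′ (suc (2 ℕ.* suc m)))  ≡⟨ ≡.cong row₂ (M′-odd m) ⟩
      row₂ (mul R′ (M′ (suc m)))     ≈⟨ row₂-R′ _ ⟩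
      row₂ (M′ (suc m))              ≈⟨ proj₂ ih ⟩
      h (suc m)                      ≈⟨ h-odd (suc m) ⟨
      h (suc (2 ℕ.* suc m))          ∎

  M′-rows : ∀ n → M′-rows≈h n
  M′-rows n = ≡.subst M′-rows≈h (toℕ-fromℕ n) (M′-rows≈h-ℕᵇ (ℕᵇ.fromℕ n))

open Hyperbinary

theorem4p4 : ∀ {c ℓ} (R : CommutativeSemiring c ℓ) (r s : CommutativeSemiring.Carrier R) →
  let open CommutativeSemiring R
      open HRS R r s
  in (hz -[1+ 0 ] ≈ 0#)
     × (hz (+ 0) ≈ 1#)
     × (∀ (n : ℤ) → + 1 ℤ.≤ n → hz ((+ 2 ℤ.* n) ℤ.- + 1) ≈ hz (n ℤ.- + 1))
     × (∀ (n : ℤ) → + 1 ℤ.≤ n → hz (+ 2 ℤ.* n) ≈ ((s * hz n) + (r * hz (n ℤ.- + 1))))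
     × (∀ (n : ℕ) → 1 ℕ.≤ n → (row₁ (M′ n) ≈ hz ((+ n) ℤ.- + 1)) × (row₂ (M′ n) ≈ hz (+ n)))
theorem4p4 R r s = refl , h-zero R r s , odd , even , matrix
  where
  open CommutativeSemiring R
  open HRS R r s
  odd : ∀ (n : ℤ) → + 1 ℤ.≤ n → hz ((+ 2 ℤ.* n) ℤ.- + 1) ≈ hz (n ℤ.- + 1)
  odd (+ suc k) (ℤ.+≤+ (ℕ.s≤s _)) =
    trans (reflexive (≡.cong (h ∘ ℕ.pred) (ℕₚ.*-suc 2 k))) (h-odd R r s k)
  even : ∀ (n : ℤ) → + 1 ℤ.≤ n → hz (+ 2 ℤ.* n) ≈ ((s * hz n) + (r * hz (n ℤ.- + 1)))
  even (+ suc k) (ℤ.+≤+ (ℕ.s≤s _)) =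
    trans (reflexive (≡.cong h (ℕₚ.*-suc 2 k))) (h-even R r s k)
  matrix : ∀ (n : ℕ) → 1 ℕ.≤ n → (row₁ (M′ n) ≈ hz ((+ n) ℤ.- + 1)) × (row₂ (M′ n) ≈ hz (+ n))
  matrix (suc k) _ = M′-rows R r s k
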